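{- Let $C_{2r},C_{2r'}$ be two even cycles, and let $\begin{pmatrix} O & A \\ A^\top & O \end{pmatrix}$ be the adjacency matrix of $C_{2r}$ (with $A$ the $r\times r$ matrix with rows indexed by $V=(v_1,\dots,v_r)$ and columns by $U=(u_1,\dots,u_r)$). Then $\lambda$ is an adjacency eigenvalue of $C_{2r}\bowtie C_{2r'}$ if and only if there exist vectors $u_i,v_i$ of length $r$ for $i\in[r']$, at least one of which is nonzero, which satisfy: \begin{align*} Au_i + u_{i+1} &= \lambda v_i \text{ for } i=1,\dots,r'-1,\\ Au_{r'} + u_1 &= \lambda v_{r'},\\ A^\top v_i + v_{i-1} &= \lambda u_i \text{ for } i=2,\dots,r',\\ A^\top v_1 + v_{r'} &= \lambda u_1. \end{align*}
   Context: For balanced bipartite graphs $G_k=(V_k\cup U_k,E_k)$ with matching orderings $V_k=(v^k_1,\dots,v^k_{n_k})$, $U_k=(u^k_1,\dots,u^k_{n_k})$ (so $(v^k_j,u^k_j)\in E_k$), the balanced bipartite product $G_1\bowtie G_2$ has vertex set $V_1\times V_2\cup U_1\times U_2$ and edges $(v^1_j,v^2)(u^1_j,u^2)$ for $(v^2,u^2)\in E_2$ and $(v^1,v^2_j)(u^1,u^2_j)$ for $(v^1,u^1)\in E_1$. The vertices of an even cycle $C_q$ are ordered so that $(v_i,u_i)$ and $(v_{i+1},u_i)$ are edges (indices cyclic). The eigenvector is written as $\tilde v=(v_1,u_1,v_2,u_2,\dots,v_{r'},u_{r'})$, where $v_i$ holds the entries on $\{(v^1_\ell,v^2_i):\ell\in[r]\}$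 and $u_i$ those on $\{(u^1_\ell,u^2_i):\ell\in[r]\}$. -}

module Defs where

open import Level using (_⊔_)
open import Data.Nat using (ℕ; zero; suc)
import Data.Nat as ℕ
open import Data.Nat.DivMod using (_mod_)
open import Data.Fin using (Fin; toℕ) renaming (zero to fz; suc to fs)
import Data.Fin as Fin
open import Data.Bool using (Bool; true; false; _∧_; _∨_; if_then_else_)
open import Data.Product using (_×_; _,_; ∃)
open import Data.Sum using (_⊎_; inj₁; inj₂)
open import Relation.Nullary using (¬_)
open import Relation.Nullary.Decidable using (⌊_⌋)
open import Relation.Binary.PropositionalEquality using (_≡_)
open import Algebra.Bundles using (CommutativeRing)

next : ∀ {n} → Fin n → Fin n
next {suc k} i = suc (toℕ i) mod suc k

prev : ∀ {n} → Fin n → Fin n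
prev {suc k} i = (toℕ i ℕ.+ k) mod suc k

_=ᶠ_ : ∀ {n} → Fin n → Fin n → Bool
i =ᶠ j = ⌊ i Fin.≟ j ⌋

-- Balanced bipartite graphs G = (V ∪ U, E) with matching orderings
-- V = (v_1..v_n), U = (u_1..u_n):  E i j = true  iff  (v_i , u_j) ∈ E.
-- Matching ordering: (v_j , u_j) ∈ E for every j.

record BBGraph : Set where
  field
    n       : ℕ
    E       : Fin n → Fin n → Bool
    matched : ∀ j → E j j ≡ true
open BBGraph public

-- The even cycle C_{2q} with vertices v_1..v_q, u_1..u_q ordered so that
-- (v_i , u_i) and (v_{i+1} , u_i) are edges (indices cyclic), i.e.
-- v_i ~ u_j  iff  j = i  or  i = j+1.
cycleE : (q : ℕ) → Fin q → Fin q → Bool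
cycleE q i j = (i =ᶠ j) ∨ (i =ᶠ next j)

cycleMatched : (q : ℕ) → ∀ j → cycleE q j j ≡ true
cycleMatched q j with j Fin.≟ j
... | Relation.Nullary.yes _ = Relation.Binary.PropositionalEquality.refl
... | Relation.Nullary.no ¬p = Data.Empty.⊥-elim (¬p Relation.Binary.PropositionalEquality.refl)
  where import Data.Empty

-- C q  denotes the cycle C_{2q}
C : ℕ → BBGraph
C q = record { n = q ; E = cycleE q ; matched = cycleMatched q }

-- Vertex set V₁×V₂ ∪ U₁×U₂, represented as (Fin n₁ × Fin n₂) ⊎ (Fin n₁ × Fin n₂)
-- (inj₁ (a , b) = (v¹_a , v²_b),  inj₂ (c , d) = (u¹_c , u²_d)).
-- (v¹_a , v²_b) ~ (u¹_c , u²_d) iff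
--   (a = c and (v²_b , u²_d) ∈ E₂)  or  (b = d and (v¹_a , u¹_c) ∈ E₁).

ProdVtx : BBGraph → BBGraph → Set
ProdVtx G₁ G₂ = (Fin (n G₁) × Fin (n G₂)) ⊎ (Fin (n G₁) × Fin (n G₂))

prodE : (G₁ G₂ : BBGraph) → Fin (n G₁) × Fin (n G₂) → Fin (n G₁) × Fin (n G₂) → Bool
prodE G₁ G₂ (a , b) (c , d) = ((a =ᶠ c) ∧ E G₂ b d) ∨ ((b =ᶠ d) ∧ E G₁ a c)

_⋈_ : (G₁ G₂ : BBGraph) → ProdVtx G₁ G₂ → ProdVtx G₁ G₂ → Bool
(G₁ ⋈ G₂) (inj₁ x) (inj₁ y) = false
(G₁ ⋈ G₂) (inj₁ x) (inj₂ y) = prodE G₁ G₂ x y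
(G₁ ⋈ G₂) (inj₂ y) (inj₁ x) = prodE G₁ G₂ x y
(G₁ ⋈ G₂) (inj₂ x) (inj₂ y) = false

module _ {c ℓ} (R : CommutativeRing c ℓ) where
  open CommutativeRing R

  sumFin : ∀ n → (Fin n → Carrier) → Carrier
  sumFin zero    f = 0#
  sumFin (suc k) f = f fz + sumFin k (λ i → f (fs i))

  ⟦_⟧ : Bool → Carrier
  ⟦ b ⟧ = if b then 1# else 0#

  sumProd : (G₁ G₂ : BBGraph) → (ProdVtx G₁ G₂ → Carrier) → Carrier
  sumProd G₁ G₂ f =
    sumFin (n G₁) (λ a → sumFin (n G₂) (λ b → f (inj₁ (a , b))))
    + sumFin (n G₁) (λ a → sumFin (n G₂) (λ b → f (inj₂ (a , b))))

  IsAdjEigenvalue⋈ : (G₁ G₂ : BBGraph) → Carrier → Set (c ⊔ ℓ)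
  IsAdjEigenvalue⋈ G₁ G₂ λ₀ =
    ∃ λ (x : ProdVtx G₁ G₂ → Carrier) →
      ¬ (∀ p → x p ≈ 0#)
      × (∀ p → sumProd G₁ G₂ (λ q → ⟦ (G₁ ⋈ G₂) p q ⟧ * x q) ≈ λ₀ * x p)

  cycleA : (r : ℕ) → Fin r → Fin r → Carrier
  cycleA r i j = ⟦ cycleE r i j ⟧

  mulA : (r : ℕ) → (Fin r → Carrier) → Fin r → Carrier
  mulA r w i = sumFin r (λ j → cycleA r i j * w j)

  mulAᵀ : (r : ℕ) → (Fin r → Carrier) → Fin r → Carrier
  mulAᵀ r w j = sumFin r (λ i → cycleA r i j * w i)

{-# OPTIONS --safe #-}
-- On the V-block, the adjacency operator of G₁ ⋈ G₂ acts as A₁ ⊗ I + I ⊗ A₂ − I: the neighbourhood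
-- of (v_a, v_b) is the cross {u_a} × N(v_b) ∪ N(v_a) × {u_b}, whose centre (u_a, u_b) lies on both
-- arms because the orderings are matching. For G₂ = C_{2r′} the part I ⊗ A₂ − I merely shifts the
-- layer b to b − 1 (and I ⊗ A₂ᵀ − I shifts it to b + 1), so the eigenvalue equations, read layer by
-- layer, are the stated system once the layers are indexed by i = −b.
module Submission where

open import Defs
open import Level using (_⊔_)
open import Algebra.Bundles using (CommutativeRing)
import Algebra.Properties.CommutativeSemigroup as CommutativeSemigroupProperties
import Algebra.Properties.Group as GroupProperties
import Algebra.Properties.Semiring.Sum as SemiringSum
open import Data.Bool using (Bool; true; false; _∧_; _∨_)
open import Data.Bool.Properties using (∧-zeroʳ)
open import Data.Fin using (Fin; toℕ; _≟_) renaming (zero to fz; suc to fs)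
open import Data.Fin.Properties using (toℕ-fromℕ<; toℕ-injective; toℕ<n; suc-injective)
open import Data.Nat using (ℕ; zero; suc; _≤_; s≤s)
open import Data.Product using (_×_; _,_; ∃₂; proj₁; proj₂)
open import Data.Sum using (inj₁; inj₂)
open import Function using (_∘_; flip)
open import Function.Bundles using (_⇔_; mk⇔)
open import Relation.Binary.PropositionalEquality as ≡ using (_≡_; _≢_; cong; cong₂)
open import Relation.Nullary using (¬_; yes; no)
open import Relation.Nullary.Decidable using (isYes≗does; does-⇔; dec-false)

module _ where
  open import Data.Nat using (_+_; _*_; _%_; NonZero)
  open import Data.Nat.DivMod
    using (_mod_; m%n<n; m%n%n≡m%n; %-distribˡ-+; %-distribˡ-*; [m+n]%n≡m%n; [m+kn]%n≡m%n; m<n⇒m%n≡m; n%n≡0)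
  open import Data.Nat.Properties using (+-comm; +-suc; *-suc; 0≢1+n; 1+n≢n; m≤n⇒m<n∨m≡n)
    renaming (suc-injective to ℕ-suc-injective)
  open ≡ using (refl; sym; trans)
  open import Data.Nat.Solver using (module +-*-Solver)
  open ≡.≡-Reasoning
  open +-*-Solver using (solve; _:+_; _:*_; _:=_; con)

  [m%d+n]%d≡[m+n]%d : ∀ m n d .{{_ : NonZero d}} → (m % d + n) % d ≡ (m + n) % d
  [m%d+n]%d≡[m+n]%d m n d = begin
    (m % d + n) % d          ≡⟨ %-distribˡ-+ (m % d) n d ⟩
    (m % d % d + n % d) % d  ≡⟨ cong (λ k → (k + n % d) % d) (m%n%n≡m%n m d) ⟩
    (m % d + n % d) % d      ≡⟨ %-distribˡ-+ m n d ⟨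
    (m + n) % d              ∎

  [m+n%d]%d≡[m+n]%d : ∀ m n d .{{_ : NonZero d}} → (m + n % d) % d ≡ (m + n) % d
  [m+n%d]%d≡[m+n]%d m n d = begin
    (m + n % d) % d          ≡⟨ %-distribˡ-+ m (n % d) d ⟩
    (m % d + n % d % d) % d  ≡⟨ cong (λ k → (m % d + k) % d) (m%n%n≡m%n n d) ⟩
    (m % d + n % d) % d      ≡⟨ %-distribˡ-+ m n d ⟨
    (m + n) % d              ∎

  [m*[n%d]]%d≡[m*n]%d : ∀ m n d .{{_ : NonZero d}} → (m * (n % d)) % d ≡ (m * n) % d
  [m*[n%d]]%d≡[m*n]%d m n d = begin
    (m * (n % d)) % d          ≡⟨ %-distribˡ-* m (n % d) d ⟩
    (m % d * (n % d % d)) % d  ≡⟨ cong (λ k → (m % d * k) % d) (m%n%n≡m%n n d) ⟩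
    (m % d * (n % d)) % d      ≡⟨ %-distribˡ-* m n d ⟨
    (m * n) % d                ∎

  toℕ-mod : ∀ m d .{{_ : NonZero d}} → toℕ (m mod d) ≡ m % d
  toℕ-mod m d = toℕ-fromℕ< (m%n<n m d)

  toℕ%n≡toℕ : ∀ {d} (i : Fin (suc d)) → toℕ i % suc d ≡ toℕ i
  toℕ%n≡toℕ i = m<n⇒m%n≡m (toℕ<n i)

  next-prev : ∀ {n} (i : Fin n) → next (prev i) ≡ i
  next-prev {suc k} i = toℕ-injective (begin
    toℕ (next (prev i))                ≡⟨ toℕ-mod (suc (toℕ (prev i))) (suc k) ⟩
    suc (toℕ (prev i)) % suc k         ≡⟨ cong (λ t → suc t % suc k) (toℕ-mod (toℕ i + k) (suc k)) ⟩
    (1 + (toℕ i + k) % suc k) % suc k  ≡⟨ [m+n%d]%d≡[m+n]%d 1 (toℕ i + k) (suc k) ⟩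
    suc (toℕ i + k) % suc k            ≡⟨ cong (_% suc k) (+-suc (toℕ i) k) ⟨
    (toℕ i + suc k) % suc k            ≡⟨ [m+n]%n≡m%n (toℕ i) (suc k) ⟩
    toℕ i % suc k                      ≡⟨ toℕ%n≡toℕ i ⟩
    toℕ i                              ∎)

  prev-next : ∀ {n} (i : Fin n) → prev (next i) ≡ i
  prev-next {suc k} i = toℕ-injective (begin
    toℕ (prev (next i))                 ≡⟨ toℕ-mod (toℕ (next i) + k) (suc k) ⟩
    (toℕ (next i) + k) % suc k          ≡⟨ cong (λ t → (t + k) % suc k) (toℕ-mod (suc (toℕ i)) (suc k)) ⟩
    (suc (toℕ i) % suc k + k) % suc k   ≡⟨ [m%d+n]%d≡[m+n]%d (suc (toℕ i)) k (suc k) ⟩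
    suc (toℕ i + k) % suc k             ≡⟨ cong (_% suc k) (+-suc (toℕ i) k) ⟨
    (toℕ i + suc k) % suc k             ≡⟨ [m+n]%n≡m%n (toℕ i) (suc k) ⟩
    toℕ i % suc k                       ≡⟨ toℕ%n≡toℕ i ⟩
    toℕ i                               ∎)

  i≢next[i] : ∀ {n} → 2 ≤ n → (i : Fin n) → i ≢ next i
  i≢next[i] {suc (suc k)} (s≤s (s≤s _)) i i≡next with m≤n⇒m<n∨m≡n (toℕ<n i)
  ... | inj₁ 1+i<n = 1+n≢n (trans (sym (m<n⇒m%n≡m 1+i<n)) 1+i%n≡i)
    where
    1+i%n≡i : suc (toℕ i) % suc (suc k) ≡ toℕ i
    1+i%n≡i = trans (sym (toℕ-mod (suc (toℕ i)) (suc (suc k)))) (cong toℕ (sym i≡next))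
  ... | inj₂ 1+i≡n = 0≢1+n (ℕ-suc-injective (trans (cong suc (sym i≡0)) 1+i≡n))
    where
    i≡0 : toℕ i ≡ 0
    i≡0 = begin
      toℕ i                        ≡⟨ cong toℕ i≡next ⟩
      toℕ (next i)                 ≡⟨ toℕ-mod (suc (toℕ i)) (suc (suc k)) ⟩
      suc (toℕ i) % suc (suc k)    ≡⟨ cong (_% suc (suc k)) 1+i≡n ⟩
      suc (suc k) % suc (suc k)    ≡⟨ n%n≡0 (suc (suc k)) ⟩
      0                            ∎

  -- i ↦ −i, as k ≡ −1 modulo suc k
  reflect : ∀ {n} → Fin n → Fin n
  reflect {suc k} i = (k * toℕ i) mod suc k

  reflect-involutive : ∀ {n} (i : Fin n) → reflect (reflect i) ≡ i
  reflect-involutive {suc zero} fz = refl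
  reflect-involutive {suc (suc k)} i = toℕ-injective (begin
    toℕ (reflect (reflect i))                      ≡⟨ toℕ-mod (suc k * toℕ (reflect i)) N ⟩
    (suc k * toℕ (reflect i)) % N                  ≡⟨ cong (λ t → (suc k * t) % N) (toℕ-mod (suc k * toℕ i) N) ⟩
    (suc k * ((suc k * toℕ i) % N)) % N            ≡⟨ [m*[n%d]]%d≡[m*n]%d (suc k) (suc k * toℕ i) N ⟩
    (suc k * (suc k * toℕ i)) % N                  ≡⟨ cong (_% N) (square≡1 k (toℕ i)) ⟩
    (toℕ i + k * toℕ i * N) % N                    ≡⟨ [m+kn]%n≡m%n (toℕ i) (k * toℕ i) N ⟩
    toℕ i % N                                      ≡⟨ toℕ%n≡toℕ i ⟩
    toℕ i                                          ∎)
    where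
    N : ℕ
    N = suc (suc k)
    square≡1 : ∀ k m → suc k * (suc k * m) ≡ m + k * m * suc (suc k)
    square≡1 = solve 2 (λ k m → (con 1 :+ k) :* ((con 1 :+ k) :* m) := m :+ k :* m :* (con 2 :+ k)) refl

  reflect-next : ∀ {n} (i : Fin n) → reflect (next i) ≡ prev (reflect i)
  reflect-next {suc k} i = toℕ-injective (begin
    toℕ (reflect (next i))                ≡⟨ toℕ-mod (k * toℕ (next i)) (suc k) ⟩
    (k * toℕ (next i)) % suc k            ≡⟨ cong (λ t → (k * t) % suc k) (toℕ-mod (suc (toℕ i)) (suc k)) ⟩
    (k * (suc (toℕ i) % suc k)) % suc k   ≡⟨ [m*[n%d]]%d≡[m*n]%d k (suc (toℕ i)) (suc k) ⟩
    (k * suc (toℕ i)) % suc k             ≡⟨ cong (_% suc k) (trans (*-suc k (toℕ i)) (+-comm k (k * toℕ i))) ⟩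
    (k * toℕ i + k) % suc k               ≡⟨ [m%d+n]%d≡[m+n]%d (k * toℕ i) k (suc k) ⟨
    ((k * toℕ i) % suc k + k) % suc k     ≡⟨ cong (λ t → (t + k) % suc k) (toℕ-mod (k * toℕ i) (suc k)) ⟨
    (toℕ (reflect i) + k) % suc k         ≡⟨ toℕ-mod (toℕ (reflect i) + k) (suc k) ⟨
    toℕ (prev (reflect i))                ∎)

  next-reflect : ∀ {n} (i : Fin n) → next (reflect i) ≡ reflect (prev i)
  next-reflect i = begin
    next (reflect i)                    ≡⟨ cong (next ∘ reflect) (next-prev i) ⟨
    next (reflect (next (prev i)))      ≡⟨ cong next (reflect-next (prev i)) ⟩
    next (prev (reflect (prev i)))      ≡⟨ next-prev (reflect (prev i)) ⟩
    reflect (prev i)                    ∎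

=ᶠ-cong : ∀ {m n} {i j : Fin m} {k l : Fin n} → (i ≡ j ⇔ k ≡ l) → (i =ᶠ j) ≡ (k =ᶠ l)
=ᶠ-cong {i = i} {j} {k} {l} i≡j⇔k≡l =
  ≡.trans (isYes≗does (i ≟ j)) (≡.trans (does-⇔ i≡j⇔k≡l (i ≟ j) (k ≟ l)) (≡.sym (isYes≗does (k ≟ l))))

=ᶠ-sym : ∀ {n} (i j : Fin n) → (i =ᶠ j) ≡ (j =ᶠ i)
=ᶠ-sym i j = =ᶠ-cong (mk⇔ ≡.sym ≡.sym)

=ᶠ-suc : ∀ {n} (i j : Fin n) → (fs i =ᶠ fs j) ≡ (i =ᶠ j)
=ᶠ-suc i j = =ᶠ-cong (mk⇔ suc-injective (cong fs))

=ᶠ-next : ∀ {n} (i j : Fin n) → (i =ᶠ next j) ≡ (prev i =ᶠ j)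
=ᶠ-next i j = =ᶠ-cong (mk⇔ (λ { ≡.refl → prev-next j }) (λ { ≡.refl → ≡.sym (next-prev i) }))

=ᶠ-∧-≢ : ∀ {n} (i : Fin n) {j k : Fin n} → j ≢ k → (i =ᶠ j) ∧ (i =ᶠ k) ≡ false
=ᶠ-∧-≢ i {j} {k} j≢k with i ≟ j
... | yes ≡.refl = ≡.trans (isYes≗does (i ≟ k)) (dec-false (i ≟ k) j≢k)
... | no _       = ≡.refl

cross-overlap : ∀ {m n} {a c : Fin m} {b d : Fin n} (P : Fin m → Bool) (Q : Fin n → Bool) →
  P a ≡ true → Q b ≡ true → ((a =ᶠ c) ∧ Q d) ∧ ((b =ᶠ d) ∧ P c) ≡ (a =ᶠ c) ∧ (b =ᶠ d)
cross-overlap {a = a} {c} {b} {d} P Q Pa≡true Qb≡true with a ≟ c | b ≟ d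
... | no _       | _          = ≡.refl
... | yes ≡.refl | no _       = ∧-zeroʳ (Q d)
... | yes ≡.refl | yes ≡.refl = cong₂ _∧_ Qb≡true Pa≡true

module _ {c ℓ} (R : CommutativeRing c ℓ) where

  open CommutativeRing R
  open SemiringSum semiring using (sum; sum-syntax; sum-cong-≋; sum-cong-≗; sum-replicate-zero; ∑-distrib-+; ∑-comm)
  open CommutativeSemigroupProperties +-commutativeSemigroup using (xy∙z≈zy∙x)
  open GroupProperties +-group using (∙-cancelʳ)
  open import Relation.Binary.Reasoning.Setoid setoid

  private
    𝟙 : Bool → Carrier
    𝟙 = ⟦_⟧ R

  sumFin≡sum : ∀ n (f : Fin n → Carrier) → sumFin R n f ≡ sum f
  sumFin≡sum zero    f = ≡.refl
  sumFin≡sum (suc n) f = cong (f fz +_) (sumFin≡sum n (f ∘ fs))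

  sumFin²≡sum² : ∀ m n (f : Fin m → Fin n → Carrier) →
    sumFin R m (λ i → sumFin R n (f i)) ≡ ∑[ i < m ] ∑[ j < n ] f i j
  sumFin²≡sum² m n f = ≡.trans (sumFin≡sum m _) (sum-cong-≗ (λ i → sumFin≡sum n (f i)))

  ∑-≈0 : ∀ {n} {f : Fin n → Carrier} → (∀ i → f i ≈ 0#) → ∑[ i < n ] f i ≈ 0#
  ∑-≈0 {n} f≈0 = trans (sum-cong-≋ f≈0) (sum-replicate-zero n)

  ∑-cong-+ : ∀ {n} {f g h k : Fin n → Carrier} → (∀ i → f i + g i ≈ h i + k i) →
    ∑[ i < n ] f i + ∑[ i < n ] g i ≈ ∑[ i < n ] h i + ∑[ i < n ] k i
  ∑-cong-+ {n} {f} {g} {h} {k} eq = begin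
    sum f + sum g               ≈⟨ ∑-distrib-+ f g ⟨
    ∑[ i < n ] (f i + g i)      ≈⟨ sum-cong-≋ eq ⟩
    ∑[ i < n ] (h i + k i)      ≈⟨ ∑-distrib-+ h k ⟩
    sum h + sum k               ∎

  𝟙-∨-∧ : ∀ p q x → 𝟙 (p ∨ q) * x + 𝟙 (p ∧ q) * x ≈ 𝟙 p * x + 𝟙 q * x
  𝟙-∨-∧ false q x = +-comm _ _
  𝟙-∨-∧ true  q x = refl

  𝟙-∨-disjoint : ∀ p q x → p ∧ q ≡ false → 𝟙 (p ∨ q) * x ≈ 𝟙 p * x + 𝟙 q * x
  𝟙-∨-disjoint false q     x _ = sym (trans (+-congʳ (zeroˡ x)) (+-identityˡ _))
  𝟙-∨-disjoint true  false x _ = sym (trans (+-congˡ (zeroˡ x)) (+-identityʳ _))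

  ∑-𝟙∧ : ∀ {n} p (q : Fin n → Bool) (f : Fin n → Carrier) →
    ∑[ i < n ] (𝟙 (p ∧ q i) * f i) ≈ 𝟙 p * ∑[ i < n ] (𝟙 (q i) * f i)
  ∑-𝟙∧ false q f = trans (∑-≈0 (λ i → zeroˡ (f i))) (sym (zeroˡ _))
  ∑-𝟙∧ true  q f = sym (*-identityˡ _)

  ∑-δ : ∀ {n} (a : Fin n) (f : Fin n → Carrier) → ∑[ i < n ] (𝟙 (a =ᶠ i) * f i) ≈ f a
  ∑-δ {suc n} fz f = begin
    1# * f fz + ∑[ i < n ] (0# * f (fs i))  ≈⟨ +-cong (*-identityˡ (f fz)) (∑-≈0 (λ i → zeroˡ (f (fs i)))) ⟩
    f fz + 0#                               ≈⟨ +-identityʳ (f fz) ⟩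
    f fz                                    ∎
  ∑-δ {suc n} (fs a) f = begin
    0# * f fz + ∑[ i < n ] (𝟙 (fs a =ᶠ fs i) * f (fs i))
      ≈⟨ +-congˡ (sum-cong-≋ (λ i → reflexive (cong (λ t → 𝟙 t * f (fs i)) (=ᶠ-suc a i)))) ⟩
    0# * f fz + ∑[ i < n ] (𝟙 (a =ᶠ i) * f (fs i))  ≈⟨ +-cong (zeroˡ (f fz)) (∑-δ a (f ∘ fs)) ⟩
    0# + f (fs a)                                   ≈⟨ +-identityˡ (f (fs a)) ⟩
    f (fs a)                                        ∎

  ∑-δ′ : ∀ {n} (a : Fin n) (f : Fin n → Carrier) → ∑[ i < n ] (𝟙 (i =ᶠ a) * f i) ≈ f a
  ∑-δ′ a f = trans (sum-cong-≋ (λ i → reflexive (cong (λ t → 𝟙 t * f i) (=ᶠ-sym i a)))) (∑-δ a f)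

  ∑-𝟙∨-disjoint : ∀ {n} (p q : Fin n → Bool) (f : Fin n → Carrier) → (∀ i → p i ∧ q i ≡ false) →
    ∑[ i < n ] (𝟙 (p i ∨ q i) * f i) ≈ ∑[ i < n ] (𝟙 (p i) * f i) + ∑[ i < n ] (𝟙 (q i) * f i)
  ∑-𝟙∨-disjoint p q f disjoint = trans
    (sum-cong-≋ (λ i → 𝟙-∨-disjoint (p i) (q i) (f i) (disjoint i)))
    (∑-distrib-+ (λ i → 𝟙 (p i) * f i) (λ i → 𝟙 (q i) * f i))

  ∑∑-δ∧ : ∀ {m n} (a : Fin m) (q : Fin n → Bool) (X : Fin m → Fin n → Carrier) →
    ∑[ c < m ] ∑[ d < n ] (𝟙 ((a =ᶠ c) ∧ q d) * X c d) ≈ ∑[ d < n ] (𝟙 (q d) * X a d)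
  ∑∑-δ∧ {n = n} a q X =
    trans (sum-cong-≋ (λ c → ∑-𝟙∧ (a =ᶠ c) q (X c))) (∑-δ a (λ c → ∑[ d < n ] (𝟙 (q d) * X c d)))

  ∑∑-cross : ∀ {m n} {a : Fin m} {b : Fin n} (P : Fin m → Bool) (Q : Fin n → Bool) →
    P a ≡ true → Q b ≡ true → (X : Fin m → Fin n → Carrier) →
    ∑[ c < m ] ∑[ d < n ] (𝟙 (((a =ᶠ c) ∧ Q d) ∨ ((b =ᶠ d) ∧ P c)) * X c d) + X a b
    ≈ ∑[ d < n ] (𝟙 (Q d) * X a d) + ∑[ c < m ] (𝟙 (P c) * X c b)
  ∑∑-cross {m} {n} {a} {b} P Q Pa≡true Qb≡true X = begin
    ∑[ c < m ] ∑[ d < n ] (𝟙 (p c d ∨ q c d) * X c d) + X a b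
      ≈⟨ +-congˡ doubleCounted ⟨
    ∑[ c < m ] ∑[ d < n ] (𝟙 (p c d ∨ q c d) * X c d) + ∑[ c < m ] ∑[ d < n ] (𝟙 (p c d ∧ q c d) * X c d)
      ≈⟨ ∑-cong-+ (λ c → ∑-cong-+ (λ d → 𝟙-∨-∧ (p c d) (q c d) (X c d))) ⟩
    ∑[ c < m ] ∑[ d < n ] (𝟙 (p c d) * X c d) + ∑[ c < m ] ∑[ d < n ] (𝟙 (q c d) * X c d)
      ≈⟨ +-cong (∑∑-δ∧ a Q X) (trans (∑-comm (λ c d → 𝟙 (q c d) * X c d)) (∑∑-δ∧ b P (flip X))) ⟩
    ∑[ d < n ] (𝟙 (Q d) * X a d) + ∑[ c < m ] (𝟙 (P c) * X c b) ∎
    where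
    p q : Fin m → Fin n → Bool
    p c d = (a =ᶠ c) ∧ Q d
    q c d = (b =ᶠ d) ∧ P c
    doubleCounted : ∑[ c < m ] ∑[ d < n ] (𝟙 (p c d ∧ q c d) * X c d) ≈ X a b
    doubleCounted = begin
      ∑[ c < m ] ∑[ d < n ] (𝟙 (p c d ∧ q c d) * X c d)
        ≡⟨ sum-cong-≗ (λ c → sum-cong-≗ (λ d → cong (λ t → 𝟙 t * X c d) (cross-overlap P Q Pa≡true Qb≡true))) ⟩
      ∑[ c < m ] ∑[ d < n ] (𝟙 ((a =ᶠ c) ∧ (b =ᶠ d)) * X c d)  ≈⟨ ∑∑-δ∧ a (b =ᶠ_) X ⟩
      ∑[ d < n ] (𝟙 (b =ᶠ d) * X a d)                           ≈⟨ ∑-δ b (X a) ⟩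
      X a b                                                     ∎

  adjMul adjMulᵀ : (G : BBGraph) → (Fin (n G) → Carrier) → Fin (n G) → Carrier
  adjMul  G w i = sumFin R (n G) (λ j → 𝟙 (E G i j) * w j)
  adjMulᵀ G w j = sumFin R (n G) (λ i → 𝟙 (E G i j) * w i)

  adjMul⋈ : (G₁ G₂ : BBGraph) → (ProdVtx G₁ G₂ → Carrier) → ProdVtx G₁ G₂ → Carrier
  adjMul⋈ G₁ G₂ x p = sumProd R G₁ G₂ (λ q → 𝟙 ((G₁ ⋈ G₂) p q) * x q)

  module _ (G₁ G₂ : BBGraph) (x : ProdVtx G₁ G₂ → Carrier) where

    private
      m₁ m₂ : ℕ
      m₁ = n G₁
      m₂ = n G₂

      xᵛ xᵘ : Fin m₁ → Fin m₂ → Carrier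
      xᵛ a b = x (inj₁ (a , b))
      xᵘ a b = x (inj₂ (a , b))

    adjMul⋈-inj₁-∑ : ∀ a b →
      adjMul⋈ G₁ G₂ x (inj₁ (a , b)) ≈ ∑[ c < m₁ ] ∑[ d < m₂ ] (𝟙 (prodE G₁ G₂ (a , b) (c , d)) * xᵘ c d)
    adjMul⋈-inj₁-∑ a b = begin
      adjMul⋈ G₁ G₂ x (inj₁ (a , b))
        ≡⟨ cong₂ _+_ (sumFin²≡sum² m₁ m₂ (λ c d → 0# * xᵛ c d))
                     (sumFin²≡sum² m₁ m₂ (λ c d → 𝟙 (prodE G₁ G₂ (a , b) (c , d)) * xᵘ c d)) ⟩
      ∑[ c < m₁ ] ∑[ d < m₂ ] (0# * xᵛ c d) + ∑[ c < m₁ ] ∑[ d < m₂ ] (𝟙 (prodE G₁ G₂ (a , b) (c , d)) * xᵘ c d)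
        ≈⟨ +-congʳ (∑-≈0 {m₁} (λ c → ∑-≈0 {m₂} (λ d → zeroˡ (xᵛ c d)))) ⟩
      0# + ∑[ c < m₁ ] ∑[ d < m₂ ] (𝟙 (prodE G₁ G₂ (a , b) (c , d)) * xᵘ c d)
        ≈⟨ +-identityˡ _ ⟩
      ∑[ c < m₁ ] ∑[ d < m₂ ] (𝟙 (prodE G₁ G₂ (a , b) (c , d)) * xᵘ c d) ∎

    adjMul⋈-inj₂-∑ : ∀ c d →
      adjMul⋈ G₁ G₂ x (inj₂ (c , d)) ≈ ∑[ a < m₁ ] ∑[ b < m₂ ] (𝟙 (prodE G₁ G₂ (a , b) (c , d)) * xᵛ a b)
    adjMul⋈-inj₂-∑ c d = begin
      adjMul⋈ G₁ G₂ x (inj₂ (c , d))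
        ≡⟨ cong₂ _+_ (sumFin²≡sum² m₁ m₂ (λ a b → 𝟙 (prodE G₁ G₂ (a , b) (c , d)) * xᵛ a b))
                     (sumFin²≡sum² m₁ m₂ (λ a b → 0# * xᵘ a b)) ⟩
      ∑[ a < m₁ ] ∑[ b < m₂ ] (𝟙 (prodE G₁ G₂ (a , b) (c , d)) * xᵛ a b) + ∑[ a < m₁ ] ∑[ b < m₂ ] (0# * xᵘ a b)
        ≈⟨ +-congˡ (∑-≈0 {m₁} (λ a → ∑-≈0 {m₂} (λ b → zeroˡ (xᵘ a b)))) ⟩
      ∑[ a < m₁ ] ∑[ b < m₂ ] (𝟙 (prodE G₁ G₂ (a , b) (c , d)) * xᵛ a b) + 0#
        ≈⟨ +-identityʳ _ ⟩
      ∑[ a < m₁ ] ∑[ b < m₂ ] (𝟙 (prodE G₁ G₂ (a , b) (c , d)) * xᵛ a b) ∎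

    adjMul⋈-inj₁ : ∀ a b →
      adjMul⋈ G₁ G₂ x (inj₁ (a , b)) + xᵘ a b ≈ adjMul G₂ (xᵘ a) b + adjMul G₁ (flip xᵘ b) a
    adjMul⋈-inj₁ a b = begin
      adjMul⋈ G₁ G₂ x (inj₁ (a , b)) + xᵘ a b
        ≈⟨ +-congʳ (adjMul⋈-inj₁-∑ a b) ⟩
      ∑[ c < m₁ ] ∑[ d < m₂ ] (𝟙 (prodE G₁ G₂ (a , b) (c , d)) * xᵘ c d) + xᵘ a b
        ≈⟨ ∑∑-cross (E G₁ a) (E G₂ b) (matched G₁ a) (matched G₂ b) xᵘ ⟩
      ∑[ d < m₂ ] (𝟙 (E G₂ b d) * xᵘ a d) + ∑[ c < m₁ ] (𝟙 (E G₁ a c) * xᵘ c b)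
        ≡⟨ cong₂ _+_ (sumFin≡sum m₂ _) (sumFin≡sum m₁ _) ⟨
      adjMul G₂ (xᵘ a) b + adjMul G₁ (flip xᵘ b) a ∎

    adjMul⋈-inj₂ : ∀ c d →
      adjMul⋈ G₁ G₂ x (inj₂ (c , d)) + xᵛ c d ≈ adjMulᵀ G₂ (xᵛ c) d + adjMulᵀ G₁ (flip xᵛ d) c
    adjMul⋈-inj₂ c d = begin
      adjMul⋈ G₁ G₂ x (inj₂ (c , d)) + xᵛ c d
        ≈⟨ +-congʳ (adjMul⋈-inj₂-∑ c d) ⟩
      ∑[ a < m₁ ] ∑[ b < m₂ ] (𝟙 (prodE G₁ G₂ (a , b) (c , d)) * xᵛ a b) + xᵛ c d
        ≡⟨ cong (_+ xᵛ c d) (sum-cong-≗ (λ a → sum-cong-≗ (λ b → cong (λ t → 𝟙 t * xᵛ a b)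
             (cong₂ (λ s t → (s ∧ E G₂ b d) ∨ (t ∧ E G₁ a c)) (=ᶠ-sym a c) (=ᶠ-sym b d))))) ⟩
      ∑[ a < m₁ ] ∑[ b < m₂ ] (𝟙 (((c =ᶠ a) ∧ E G₂ b d) ∨ ((d =ᶠ b) ∧ E G₁ a c)) * xᵛ a b) + xᵛ c d
        ≈⟨ ∑∑-cross (λ a → E G₁ a c) (λ b → E G₂ b d) (matched G₁ c) (matched G₂ d) xᵛ ⟩
      ∑[ b < m₂ ] (𝟙 (E G₂ b d) * xᵛ c b) + ∑[ a < m₁ ] (𝟙 (E G₁ a c) * xᵛ a d)
        ≡⟨ cong₂ _+_ (sumFin≡sum m₂ _) (sumFin≡sum m₁ _) ⟨
      adjMulᵀ G₂ (xᵛ c) d + adjMulᵀ G₁ (flip xᵛ d) c ∎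

  mulA-expand : ∀ {r} → 2 ≤ r → (w : Fin r → Carrier) (i : Fin r) → mulA R r w i ≈ w i + w (prev i)
  mulA-expand {r} 2≤r w i = begin
    mulA R r w i
      ≡⟨ sumFin≡sum r (λ j → 𝟙 ((i =ᶠ j) ∨ (i =ᶠ next j)) * w j) ⟩
    ∑[ j < r ] (𝟙 ((i =ᶠ j) ∨ (i =ᶠ next j)) * w j)
      ≈⟨ ∑-𝟙∨-disjoint (i =ᶠ_) (λ j → i =ᶠ next j) w (λ j → =ᶠ-∧-≢ i (i≢next[i] 2≤r j)) ⟩
    ∑[ j < r ] (𝟙 (i =ᶠ j) * w j) + ∑[ j < r ] (𝟙 (i =ᶠ next j) * w j)
      ≡⟨ cong (∑[ j < r ] (𝟙 (i =ᶠ j) * w j) +_) (sum-cong-≗ (λ j → cong (λ t → 𝟙 t * w j) (=ᶠ-next i j))) ⟩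
    ∑[ j < r ] (𝟙 (i =ᶠ j) * w j) + ∑[ j < r ] (𝟙 (prev i =ᶠ j) * w j)
      ≈⟨ +-cong (∑-δ i w) (∑-δ (prev i) w) ⟩
    w i + w (prev i) ∎

  mulAᵀ-expand : ∀ {r} → 2 ≤ r → (w : Fin r → Carrier) (j : Fin r) → mulAᵀ R r w j ≈ w j + w (next j)
  mulAᵀ-expand {r} 2≤r w j = begin
    mulAᵀ R r w j
      ≡⟨ sumFin≡sum r (λ i → 𝟙 ((i =ᶠ j) ∨ (i =ᶠ next j)) * w i) ⟩
    ∑[ i < r ] (𝟙 ((i =ᶠ j) ∨ (i =ᶠ next j)) * w i)
      ≈⟨ ∑-𝟙∨-disjoint (_=ᶠ j) (_=ᶠ next j) w (λ i → =ᶠ-∧-≢ i (i≢next[i] 2≤r j)) ⟩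
    ∑[ i < r ] (𝟙 (i =ᶠ j) * w i) + ∑[ i < r ] (𝟙 (i =ᶠ next j) * w i)
      ≈⟨ +-cong (∑-δ′ j w) (∑-δ′ (next j) w) ⟩
    w j + w (next j) ∎

  module _ (r : ℕ) {r′ : ℕ} (2≤r′ : 2 ≤ r′) (x : ProdVtx (C r) (C r′) → Carrier) where

    adjMul⋈C-inj₁ : ∀ a b →
      adjMul⋈ (C r) (C r′) x (inj₁ (a , b)) ≈ mulA R r (λ c → x (inj₂ (c , b))) a + x (inj₂ (a , prev b))
    adjMul⋈C-inj₁ a b = ∙-cancelʳ (x (inj₂ (a , b))) _ _ (begin
      adjMul⋈ (C r) (C r′) x (inj₁ (a , b)) + x (inj₂ (a , b))
        ≈⟨ adjMul⋈-inj₁ (C r) (C r′) x a b ⟩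
      mulA R r′ (λ d → x (inj₂ (a , d))) b + mulA R r (λ c → x (inj₂ (c , b))) a
        ≈⟨ +-congʳ (mulA-expand 2≤r′ (λ d → x (inj₂ (a , d))) b) ⟩
      x (inj₂ (a , b)) + x (inj₂ (a , prev b)) + mulA R r (λ c → x (inj₂ (c , b))) a
        ≈⟨ xy∙z≈zy∙x _ _ _ ⟩
      mulA R r (λ c → x (inj₂ (c , b))) a + x (inj₂ (a , prev b)) + x (inj₂ (a , b)) ∎)

    adjMul⋈C-inj₂ : ∀ c d →
      adjMul⋈ (C r) (C r′) x (inj₂ (c , d)) ≈ mulAᵀ R r (λ a → x (inj₁ (a , d))) c + x (inj₁ (c , next d))
    adjMul⋈C-inj₂ c d = ∙-cancelʳ (x (inj₁ (c , d))) _ _ (begin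
      adjMul⋈ (C r) (C r′) x (inj₂ (c , d)) + x (inj₁ (c , d))
        ≈⟨ adjMul⋈-inj₂ (C r) (C r′) x c d ⟩
      mulAᵀ R r′ (λ b → x (inj₁ (c , b))) d + mulAᵀ R r (λ a → x (inj₁ (a , d))) c
        ≈⟨ +-congʳ (mulAᵀ-expand 2≤r′ (λ b → x (inj₁ (c , b))) d) ⟩
      x (inj₁ (c , d)) + x (inj₁ (c , next d)) + mulAᵀ R r (λ a → x (inj₁ (a , d))) c
        ≈⟨ xy∙z≈zy∙x _ _ _ ⟩
      mulAᵀ R r (λ a → x (inj₁ (a , d))) c + x (inj₁ (c , next d)) + x (inj₁ (c , d)) ∎)

  CycleEigenSystem : (r r′ : ℕ) → Carrier → Set (c ⊔ ℓ)
  CycleEigenSystem r r′ λ₀ = ∃₂ (λ (v u : Fin r′ → Fin r → Carrier) →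
    ¬ (∀ i l → (v i l ≈ 0#) × (u i l ≈ 0#))
    × (∀ i l → mulA R r (u i) l + u (next i) l ≈ λ₀ * v i l)
    × (∀ i l → mulAᵀ R r (v i) l + v (prev i) l ≈ λ₀ * u i l))

  eigenvector⇒cycleSystem : ∀ {r r′} → 2 ≤ r′ → ∀ {λ₀} →
    IsAdjEigenvalue⋈ R (C r) (C r′) λ₀ → CycleEigenSystem r r′ λ₀
  eigenvector⇒cycleSystem {r} {r′} 2≤r′ {λ₀} (x , x≉0 , Ax≈λx) = v , u , v,u≉0 , equationV , equationU
    where
    v u : Fin r′ → Fin r → Carrier
    v i l = x (inj₁ (l , reflect i))
    u i l = x (inj₂ (l , reflect i))

    v,u≉0 : ¬ (∀ i l → (v i l ≈ 0#) × (u i l ≈ 0#))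
    v,u≉0 v,u≈0 = x≉0 λ
      { (inj₁ (a , b)) → ≡.subst (λ t → x (inj₁ (a , t)) ≈ 0#) (reflect-involutive b)
                                 (proj₁ (v,u≈0 (reflect b) a))
      ; (inj₂ (a , b)) → ≡.subst (λ t → x (inj₂ (a , t)) ≈ 0#) (reflect-involutive b)
                                 (proj₂ (v,u≈0 (reflect b) a))
      }

    equationV : ∀ i l → mulA R r (u i) l + u (next i) l ≈ λ₀ * v i l
    equationV i l = begin
      mulA R r (u i) l + x (inj₂ (l , reflect (next i)))
        ≡⟨ cong (λ t → mulA R r (u i) l + x (inj₂ (l , t))) (reflect-next i) ⟩
      mulA R r (u i) l + x (inj₂ (l , prev (reflect i)))
        ≈⟨ adjMul⋈C-inj₁ r 2≤r′ x l (reflect i) ⟨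
      adjMul⋈ (C r) (C r′) x (inj₁ (l , reflect i))
        ≈⟨ Ax≈λx (inj₁ (l , reflect i)) ⟩
      λ₀ * v i l ∎

    equationU : ∀ i l → mulAᵀ R r (v i) l + v (prev i) l ≈ λ₀ * u i l
    equationU i l = begin
      mulAᵀ R r (v i) l + x (inj₁ (l , reflect (prev i)))
        ≡⟨ cong (λ t → mulAᵀ R r (v i) l + x (inj₁ (l , t))) (next-reflect i) ⟨
      mulAᵀ R r (v i) l + x (inj₁ (l , next (reflect i)))
        ≈⟨ adjMul⋈C-inj₂ r 2≤r′ x l (reflect i) ⟨
      adjMul⋈ (C r) (C r′) x (inj₂ (l , reflect i))
        ≈⟨ Ax≈λx (inj₂ (l , reflect i)) ⟩
      λ₀ * u i l ∎

  cycleSystem⇒eigenvector : ∀ {r r′} → 2 ≤ r′ → ∀ {λ₀} →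
    CycleEigenSystem r r′ λ₀ → IsAdjEigenvalue⋈ R (C r) (C r′) λ₀
  cycleSystem⇒eigenvector {r} {r′} 2≤r′ {λ₀} (v , u , v,u≉0 , equationV , equationU) = x , x≉0 , Ax≈λx
    where
    x : ProdVtx (C r) (C r′) → Carrier
    x (inj₁ (a , b)) = v (reflect b) a
    x (inj₂ (a , b)) = u (reflect b) a

    x≉0 : ¬ (∀ p → x p ≈ 0#)
    x≉0 x≈0 = v,u≉0 λ i l →
        ≡.subst (λ t → v t l ≈ 0#) (reflect-involutive i) (x≈0 (inj₁ (l , reflect i)))
      , ≡.subst (λ t → u t l ≈ 0#) (reflect-involutive i) (x≈0 (inj₂ (l , reflect i)))

    Ax≈λx : ∀ p → adjMul⋈ (C r) (C r′) x p ≈ λ₀ * x p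
    Ax≈λx (inj₁ (a , b)) = begin
      adjMul⋈ (C r) (C r′) x (inj₁ (a , b))
        ≈⟨ adjMul⋈C-inj₁ r 2≤r′ x a b ⟩
      mulA R r (u (reflect b)) a + u (reflect (prev b)) a
        ≡⟨ cong (λ t → mulA R r (u (reflect b)) a + u t a) (next-reflect b) ⟨
      mulA R r (u (reflect b)) a + u (next (reflect b)) a
        ≈⟨ equationV (reflect b) a ⟩
      λ₀ * v (reflect b) a ∎
    Ax≈λx (inj₂ (c , d)) = begin
      adjMul⋈ (C r) (C r′) x (inj₂ (c , d))
        ≈⟨ adjMul⋈C-inj₂ r 2≤r′ x c d ⟩
      mulAᵀ R r (v (reflect d)) c + v (reflect (next d)) c
        ≡⟨ cong (λ t → mulAᵀ R r (v (reflect d)) c + v t c) (reflect-next d) ⟩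
      mulAᵀ R r (v (reflect d)) c + v (prev (reflect d)) c
        ≈⟨ equationU (reflect d) c ⟩
      λ₀ * u (reflect d) c ∎

corollary4p5 : ∀ {c ℓ} (R : CommutativeRing c ℓ) (r r' : ℕ) → 2 ≤ r → 2 ≤ r' →
    (λ₀ : CommutativeRing.Carrier R) →
    IsAdjEigenvalue⋈ R (C r) (C r') λ₀
    ⇔
    ∃₂ (λ (v u : Fin r' → Fin r → CommutativeRing.Carrier R) →
      ¬ (∀ i ℓ₀ → (CommutativeRing._≈_ R (v i ℓ₀) (CommutativeRing.0# R))
                  × (CommutativeRing._≈_ R (u i ℓ₀) (CommutativeRing.0# R)))
      × (∀ i ℓ₀ → CommutativeRing._≈_ R
           (CommutativeRing._+_ R (mulA R r (u i) ℓ₀) (u (next i) ℓ₀))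
           (CommutativeRing._*_ R λ₀ (v i ℓ₀)))
      × (∀ i ℓ₀ → CommutativeRing._≈_ R
           (CommutativeRing._+_ R (mulAᵀ R r (v i) ℓ₀) (v (prev i) ℓ₀))
           (CommutativeRing._*_ R λ₀ (u i ℓ₀))))
corollary4p5 R r r' _ 2≤r' λ₀ =
  mk⇔ (eigenvector⇒cycleSystem R 2≤r') (cycleSystem⇒eigenvector R 2≤r')
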